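{- Let $Y_1,Y_2,\ldots$ be i.i.d. Bernoulli$(1/2)$ and let $(Z^k)_{k\ge2}$ be generated by the bit-drop scheme (see context), independently of $Y$. Let $L^a_n(k)$ denote the length of the longest common subsequence of $Z^k$ and $Y_1\ldots Y_n$. Let $E^n_1$ be the event that $L^a_n(k)=k$ for all $k$ with $1\le k\le 0.45n$. Then $\lim_{n\to\infty}P(E^n_1)=1$.
   Context: Bit-drop scheme: let $V_1,V_2,\ldots$ be i.i.d. Bernoulli$(1/2)$ variables and $T_3,T_4,\ldots$ independent integer variables, independent of $\{V_k\}$, with $T_{k+1}$ uniformly distributed on $\{2,\ldots,k\}$. Set $Z^2:=V_1V_2$; $Z^{k+1}$ is obtained from $Z^k=Z^k_1\ldots Z^k_k$ by inserting $V_{k+1}$ at position $T_{k+1}$, i.e. $Z^{k+1}_j=Z^k_j$ for $j<T_{k+1}$, $Z^{k+1}_{T_{k+1}}=V_{k+1}$, $Z^{k+1}_j=Z^k_{j-1}$ for $T_{k+1}<j\le k+1$. -}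

module Defs where

open import Data.Bool using (Bool; true; false; if_then_else_)
open import Data.Nat using (ℕ; zero; suc; _+_; _*_; _∸_; _⊔_; _≡ᵇ_)
import Data.Nat as ℕ
open import Data.List using (List; []; _∷_; _++_; [_]; map; concatMap; upTo; length; filterᵇ)
open import Data.Bool.ListAction using (and)
open import Data.Product using (_×_; _,_)
open import Data.Integer using (+_)
open import Data.Rational using (ℚ; 0ℚ; _/_)

_==_ : Bool → Bool → Bool
false == false = true
true  == true  = true
_     == _     = false

lcs : List Bool → List Bool → ℕ
lcs [] _ = 0
lcs (x ∷ xs) [] = 0
lcs (x ∷ xs) (y ∷ ys) =
  if x == y then suc (lcs xs ys) else (lcs xs (y ∷ ys) ⊔ lcs (x ∷ xs) ys)

-- 1-indexed lookups with default values
bitAt : List Bool → ℕ → Bool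
bitAt [] _ = false
bitAt (x ∷ xs) zero = false
bitAt (x ∷ xs) (suc zero) = x
bitAt (x ∷ xs) (suc (suc i)) = bitAt xs (suc i)

natAt : List ℕ → ℕ → ℕ
natAt [] _ = 0
natAt (x ∷ xs) zero = x
natAt (x ∷ xs) (suc i) = natAt xs i

-- insertAt j b xs : insert b so that it ends up at position j (1-indexed), j ≥ 1
insertAt : ℕ → Bool → List Bool → List Bool
insertAt zero b xs = b ∷ xs
insertAt (suc zero) b xs = b ∷ xs
insertAt (suc (suc j)) b [] = b ∷ []
insertAt (suc (suc j)) b (x ∷ xs) = x ∷ insertAt (suc j) b xs

-- Bit-drop scheme: V k = V_k, T k = T_k.  Z V T k = Z^k.
-- Z^1 := V_1 (the first letter of every Z^k, k ≥ 2); Z^0 is unused.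
Zk : (ℕ → Bool) → (ℕ → ℕ) → ℕ → List Bool
Zk V T zero = []
Zk V T (suc zero) = V 1 ∷ []
Zk V T (suc (suc zero)) = V 1 ∷ V 2 ∷ []
Zk V T (suc (suc (suc k))) = insertAt (T (3 + k)) (V (3 + k)) (Zk V T (suc (suc k)))

-- All bit strings of length n (each equally likely under i.i.d. Bernoulli(1/2)).
bitStrings : ℕ → List (List Bool)
bitStrings zero = [] ∷ []
bitStrings (suc n) = concatMap (λ xs → (false ∷ xs) ∷ (true ∷ xs) ∷ []) (bitStrings n)

-- All possible values [T_3, …, T_m], T_{k+1} ∈ {2,…,k} (each equally likely).
tLists : ℕ → List (List ℕ)
tLists zero = [] ∷ []
tLists (suc zero) = [] ∷ []
tLists (suc (suc zero)) = [] ∷ []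
tLists (suc (suc (suc k))) =
  concatMap (λ ts → map (λ t → ts ++ [ t ]) (map (λ i → 2 + i) (upTo (suc k)))) (tLists (suc (suc k)))

m45 : ℕ → ℕ
m45 n = (9 * n) ℕ./ 20

-- Finite sample space for E^n_1: (Y_1..Y_n, V_1..V_m, T_3..T_m), m = ⌊0.45n⌋, uniform.
Ω : ℕ → List (List Bool × List Bool × List ℕ)
Ω n = concatMap (λ y → concatMap (λ vs → map (λ ts → (y , vs , ts)) (tLists (m45 n)))
                                  (bitStrings (m45 n)))
                (bitStrings n)

E1 : ℕ → List Bool × List Bool × List ℕ → Bool
E1 n (y , vs , ts) =
  and (map (λ k → lcs (Zk (bitAt vs) (λ j → natAt ts (j ∸ 3)) k) y ≡ᵇ k)
      (map suc (upTo (m45 n))))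

prob : {A : Set} → (A → Bool) → List A → ℚ
prob P [] = 0ℚ
prob P (x ∷ xs) = + length (filterᵇ P (x ∷ xs)) / suc (length xs)

PE1 : ℕ → ℚ
PE1 n = prob (E1 n) (Ω n)

module Submission where

-- Bits are only ever inserted, so Z^k is a subsequence of Z^m for k ≤ m = ⌊0.45 n⌋, and E^n_1 holds
-- whenever Z^m is a subsequence of Y.  For any fixed word w of length m, the number of n-bit strings
-- not containing w as a subsequence satisfies Pascal's rule, hence equals Σ_{i<m} C(n,i) whatever w is.
-- A Chernoff bound with ratio 9/11 gives Σ_{i<m} C(n,i) ≤ (2ρ)^n with ρ^20 = (11/9)^9 (10/11)^20 < 1,
-- so the failure probability is at most ρ^n, uniformly in (V, T).

open import Defs
open import Data.Bool using (Bool; true; false; if_then_else_; T) renaming (_≟_ to _≟ᵇ_)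
open import Data.List using (List; []; _∷_; _++_; map; concatMap; length; filterᵇ)
open import Data.Product using (_×_; _,_; ∃-syntax)
open import Relation.Binary.PropositionalEquality
  using (_≡_; _≢_; refl; sym; trans; cong; cong₂; subst; subst₂; module ≡-Reasoning)

module Counting where

  open import Data.Nat
    using (ℕ; zero; suc; _+_; _*_; _∸_; _^_; _≤_; _<_; z≤n; s≤s; _≡ᵇ_; _≤′_; ≤′-refl; ≤′-step; >-nonZero)
  open import Data.Nat.Properties
  open import Data.Nat.DivMod using (m/n*n≤m)
  open import Data.Nat.Solver using (module +-*-Solver)
  open +-*-Solver using (solve; _:+_; _:*_; _:^_; _:=_; con)
  open import Algebra.Properties.CommutativeSemigroup +-commutativeSemigroup
    using () renaming (interchange to +-interchange)
  open import Algebra.Properties.CommutativeSemigroup *-commutativeSemigroup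
    using (x∙yz≈y∙xz) renaming (interchange to *-interchange)
  open import Data.List.Relation.Binary.Sublist.DecPropositional _≟ᵇ_
    using (_⊆_; []; _∷_; _∷ʳ_; ⊆-refl; ⊆-trans; _⊆?_)
  open import Data.List.Relation.Binary.Sublist.Propositional.Properties using (∷⁻; ∷ʳ⁻)
  import Data.List.Relation.Unary.All as All
  import Data.List.Relation.Unary.All.Properties as All
  open import Relation.Nullary using (Dec; yes; no; does)
  open import Data.Empty using (⊥-elim)

  sumBy : {A : Set} → (A → ℕ) → List A → ℕ
  sumBy f []       = 0
  sumBy f (x ∷ xs) = f x + sumBy f xs

  module _ {A : Set} where

    sumBy-++ : ∀ (f : A → ℕ) xs ys → sumBy f (xs ++ ys) ≡ sumBy f xs + sumBy f ys
    sumBy-++ f []       ys = refl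
    sumBy-++ f (x ∷ xs) ys = trans (cong (f x +_) (sumBy-++ f xs ys)) (sym (+-assoc (f x) _ _))

    sumBy-cong : ∀ {f g : A → ℕ} → (∀ x → f x ≡ g x) → ∀ xs → sumBy f xs ≡ sumBy g xs
    sumBy-cong f≗g []       = refl
    sumBy-cong f≗g (x ∷ xs) = cong₂ _+_ (f≗g x) (sumBy-cong f≗g xs)

    sumBy-mono : ∀ {f g : A → ℕ} → (∀ x → f x ≤ g x) → ∀ xs → sumBy f xs ≤ sumBy g xs
    sumBy-mono f≤g []       = z≤n
    sumBy-mono f≤g (x ∷ xs) = +-mono-≤ (f≤g x) (sumBy-mono f≤g xs)

    sumBy-+ : ∀ (f g : A → ℕ) xs → sumBy (λ x → f x + g x) xs ≡ sumBy f xs + sumBy g xs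
    sumBy-+ f g []       = refl
    sumBy-+ f g (x ∷ xs) = begin
      f x + g x + sumBy (λ x → f x + g x) xs ≡⟨ cong (f x + g x +_) (sumBy-+ f g xs) ⟩
      f x + g x + (sumBy f xs + sumBy g xs)  ≡⟨ +-interchange (f x) (g x) _ _ ⟩
      f x + sumBy f xs + (g x + sumBy g xs)  ∎
      where open ≡-Reasoning

    sumBy-const : ∀ c (xs : List A) → sumBy (λ _ → c) xs ≡ length xs * c
    sumBy-const c []       = refl
    sumBy-const c (x ∷ xs) = cong (c +_) (sumBy-const c xs)

  module _ {A B : Set} where

    sumBy-map : ∀ (f : B → ℕ) (g : A → B) xs → sumBy f (map g xs) ≡ sumBy (λ x → f (g x)) xs
    sumBy-map f g []       = refl
    sumBy-map f g (x ∷ xs) = cong (f (g x) +_) (sumBy-map f g xs)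

    sumBy-concatMap : ∀ (f : B → ℕ) (g : A → List B) xs →
                      sumBy f (concatMap g xs) ≡ sumBy (λ x → sumBy f (g x)) xs
    sumBy-concatMap f g []       = refl
    sumBy-concatMap f g (x ∷ xs) =
      trans (sumBy-++ f (g x) (concatMap g xs)) (cong (sumBy f (g x) +_) (sumBy-concatMap f g xs))

    sumBy-swap : ∀ (f : A → B → ℕ) xs ys →
                 sumBy (λ x → sumBy (f x) ys) xs ≡ sumBy (λ y → sumBy (λ x → f x y) xs) ys
    sumBy-swap f []       ys = sym (trans (sumBy-const 0 ys) (*-zeroʳ (length ys)))
    sumBy-swap f (x ∷ xs) ys = begin
      sumBy (f x) ys + sumBy (λ x → sumBy (f x) ys) xs
        ≡⟨ cong (sumBy (f x) ys +_) (sumBy-swap f xs ys) ⟩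
      sumBy (f x) ys + sumBy (λ y → sumBy (λ x → f x y) xs) ys
        ≡⟨ sumBy-+ (f x) _ ys ⟨
      sumBy (λ y → f x y + sumBy (λ x → f x y) xs) ys
        ∎
      where open ≡-Reasoning

  length≡sumBy1 : ∀ {A : Set} (xs : List A) → length xs ≡ sumBy (λ _ → 1) xs
  length≡sumBy1 xs = sym (trans (sumBy-const 1 xs) (*-identityʳ (length xs)))

  triples : {A B C : Set} → List A → List B → List C → List (A × B × C)
  triples xs ys zs = concatMap (λ x → concatMap (λ y → map (λ z → (x , y , z)) zs) ys) xs

  sumBy-triples : ∀ {A B C : Set} (h : A × B × C → ℕ) xs ys zs →
    sumBy h (triples xs ys zs) ≡ sumBy (λ y → sumBy (λ z → sumBy (λ x → h (x , y , z)) xs) zs) ys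
  sumBy-triples h xs ys zs = begin
    sumBy h (triples xs ys zs)
      ≡⟨ sumBy-concatMap h _ xs ⟩
    sumBy (λ x → sumBy h (concatMap (λ y → map (λ z → (x , y , z)) zs) ys)) xs
      ≡⟨ sumBy-cong (λ x → trans (sumBy-concatMap h _ ys) (sumBy-cong (λ y → sumBy-map h _ zs) ys)) xs ⟩
    sumBy (λ x → sumBy (λ y → sumBy (λ z → h (x , y , z)) zs) ys) xs
      ≡⟨ sumBy-swap (λ x y → sumBy (λ z → h (x , y , z)) zs) xs ys ⟩
    sumBy (λ y → sumBy (λ x → sumBy (λ z → h (x , y , z)) zs) xs) ys
      ≡⟨ sumBy-cong (λ y → sumBy-swap (λ x z → h (x , y , z)) xs zs) ys ⟩
    sumBy (λ y → sumBy (λ z → sumBy (λ x → h (x , y , z)) xs) zs) ys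
      ∎
    where open ≡-Reasoning

  𝟙¬ : Bool → ℕ
  𝟙¬ true  = 0
  𝟙¬ false = 1

  𝟙¬-≤-dec : ∀ {A : Set} {b} (A? : Dec A) → (A → T b) → 𝟙¬ b ≤ 𝟙¬ (does A?)
  𝟙¬-≤-dec {b = true}  _       _   = z≤n
  𝟙¬-≤-dec {b = false} (no _)  _   = ≤-refl
  𝟙¬-≤-dec {b = false} (yes a) a⇒b = ⊥-elim (a⇒b a)

  failures : {A : Set} → (A → Bool) → List A → ℕ
  failures P = sumBy (λ x → 𝟙¬ (P x))

  length-filterᵇ+failures : ∀ {A : Set} (P : A → Bool) xs →
                            length (filterᵇ P xs) + failures P xs ≡ length xs
  length-filterᵇ+failures P []       = refl
  length-filterᵇ+failures P (x ∷ xs) with P x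
  ... | true  = cong suc (length-filterᵇ+failures P xs)
  ... | false = trans (+-suc _ _) (cong suc (length-filterᵇ+failures P xs))

  ==-false⇒≢ : ∀ {a b} → (a == b) ≡ false → a ≢ b
  ==-false⇒≢ {false} () refl
  ==-false⇒≢ {true}  () refl

  lcs≤length : ∀ w y → lcs w y ≤ length w
  lcs≤length []      y       = z≤n
  lcs≤length (a ∷ w) []      = z≤n
  lcs≤length (a ∷ w) (b ∷ y) =
    if-≤ (a == b) (s≤s (lcs≤length w y))
         (⊔-lub (m≤n⇒m≤1+n (lcs≤length w (b ∷ y))) (lcs≤length (a ∷ w) y))
    where
    if-≤ : ∀ c {x x′ z} → x ≤ z → x′ ≤ z → (if c then x else x′) ≤ z
    if-≤ true  x≤z _  = x≤z
    if-≤ false _ x′≤z = x′≤z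

  length≤lcs : ∀ {w y} → w ⊆ y → length w ≤ lcs w y
  length≤lcs {[]}             _ = z≤n
  length≤lcs {a ∷ w} {[]}     ()
  length≤lcs {a ∷ w} {b ∷ y}  p with a == b in a==b
  ... | true  = s≤s (length≤lcs (∷⁻ p))
  ... | false = ≤-trans (length≤lcs (∷ʳ⁻ (==-false⇒≢ a==b) p)) (m≤n⊔m _ _)

  lcs-⊆ : ∀ {w y} → w ⊆ y → lcs w y ≡ length w
  lcs-⊆ {w} {y} w⊆y = ≤-antisym (lcs≤length w y) (length≤lcs w⊆y)

  length-insertAt : ∀ j b xs → length (insertAt j b xs) ≡ suc (length xs)
  length-insertAt zero          b xs       = refl
  length-insertAt (suc zero)    b xs       = refl
  length-insertAt (suc (suc j)) b []       = refl
  length-insertAt (suc (suc j)) b (x ∷ xs) = cong suc (length-insertAt (suc j) b xs)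

  ⊆-insertAt : ∀ j b xs → xs ⊆ insertAt j b xs
  ⊆-insertAt zero          b xs       = b ∷ʳ ⊆-refl
  ⊆-insertAt (suc zero)    b xs       = b ∷ʳ ⊆-refl
  ⊆-insertAt (suc (suc j)) b []       = b ∷ʳ []
  ⊆-insertAt (suc (suc j)) b (x ∷ xs) = refl ∷ ⊆-insertAt (suc j) b xs

  module _ (V : ℕ → Bool) (T : ℕ → ℕ) where

    length-Zk : ∀ k → length (Zk V T k) ≡ k
    length-Zk zero                = refl
    length-Zk (suc zero)          = refl
    length-Zk (suc (suc zero))    = refl
    length-Zk (suc (suc (suc k))) =
      trans (length-insertAt (T (3 + k)) (V (3 + k)) (Zk V T (suc (suc k)))) (cong suc (length-Zk (suc (suc k))))

    Zk-⊆-suc : ∀ k → Zk V T k ⊆ Zk V T (suc k)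
    Zk-⊆-suc zero          = V 1 ∷ʳ []
    Zk-⊆-suc (suc zero)    = refl ∷ (V 2 ∷ʳ [])
    Zk-⊆-suc (suc (suc k)) = ⊆-insertAt _ _ _

    Zk-mono : ∀ {k l} → k ≤′ l → Zk V T k ⊆ Zk V T l
    Zk-mono ≤′-refl            = ⊆-refl
    Zk-mono (≤′-step {l} k≤′l) = ⊆-trans (Zk-mono k≤′l) (Zk-⊆-suc l)

  ZkOf : List Bool → List ℕ → ℕ → List Bool
  ZkOf vs ts = Zk (bitAt vs) (λ j → natAt ts (j ∸ 3))

  E1-if-⊆ : ∀ n y vs ts → ZkOf vs ts (m45 n) ⊆ y → T (E1 n (y , vs , ts))
  E1-if-⊆ n y vs ts Zm⊆y =
    All.all⁻ _ (All.map⁺ (All.map full-prefix (All.all-upTo (m45 n))))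
    where
    full-prefix : ∀ {k} → k < m45 n → T (lcs (ZkOf vs ts (suc k)) y ≡ᵇ suc k)
    full-prefix {k} k<m = ≡⇒≡ᵇ _ _ (begin
      lcs (ZkOf vs ts (suc k)) y  ≡⟨ lcs-⊆ (⊆-trans (Zk-mono _ _ (≤⇒≤′ k<m)) Zm⊆y) ⟩
      length (ZkOf vs ts (suc k)) ≡⟨ length-Zk _ _ (suc k) ⟩
      suc k                       ∎)
      where open ≡-Reasoning

  -- Σ_{i<m} C(n,i), generated by Pascal's rule.
  binomialPrefix : ℕ → ℕ → ℕ
  binomialPrefix zero    n       = 0
  binomialPrefix (suc m) zero    = 1
  binomialPrefix (suc m) (suc n) = binomialPrefix (suc m) n + binomialPrefix m n

  avoidsOf : List Bool → List Bool → ℕ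
  avoidsOf w y = 𝟙¬ (does (w ⊆? y))

  avoiders : List Bool → ℕ → ℕ
  avoiders w n = sumBy (avoidsOf w) (bitStrings n)

  -- A string starting with the first letter of w avoids w iff its tail avoids the tail of w;
  -- otherwise iff its tail avoids w.
  avoiders≡binomialPrefix : ∀ w n → avoiders w n ≡ binomialPrefix (length w) n
  avoiders≡binomialPrefix []      n       = trans (sumBy-const 0 (bitStrings n)) (*-zeroʳ (length (bitStrings n)))
  avoiders≡binomialPrefix (a ∷ w) zero    = refl
  avoiders≡binomialPrefix (a ∷ w) (suc n) = begin
    avoiders (a ∷ w) (suc n)
      ≡⟨ sumBy-concatMap (avoidsOf (a ∷ w)) _ (bitStrings n) ⟩
    sumBy (λ y → avoidsOf (a ∷ w) (false ∷ y) + (avoidsOf (a ∷ w) (true ∷ y) + 0)) (bitStrings n)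
      ≡⟨ sumBy-cong (split a) (bitStrings n) ⟩
    sumBy (λ y → avoidsOf (a ∷ w) y + avoidsOf w y) (bitStrings n)
      ≡⟨ sumBy-+ (avoidsOf (a ∷ w)) (avoidsOf w) (bitStrings n) ⟩
    avoiders (a ∷ w) n + avoiders w n
      ≡⟨ cong₂ _+_ (avoiders≡binomialPrefix (a ∷ w) n) (avoiders≡binomialPrefix w n) ⟩
    binomialPrefix (suc (length w)) n + binomialPrefix (length w) n
      ∎
    where
    open ≡-Reasoning
    split : ∀ c y → avoidsOf (c ∷ w) (false ∷ y) + (avoidsOf (c ∷ w) (true ∷ y) + 0)
                  ≡ avoidsOf (c ∷ w) y + avoidsOf w y
    split false y = trans (cong (avoidsOf w y +_) (+-identityʳ _)) (+-comm (avoidsOf w y) _)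
    split true  y = cong (avoidsOf (true ∷ w) y +_) (+-identityʳ _)

  binomialPrefix-chernoff : ∀ {p q} → p ≤ q → ∀ m n →
                            binomialPrefix m n * (p ^ m * q ^ n) ≤ q ^ m * (p + q) ^ n
  binomialPrefix-chernoff p≤q zero    n    = z≤n
  binomialPrefix-chernoff {p} {q} p≤q (suc m) zero =
    ≤-trans (≤-reflexive (*-identityˡ _)) (*-monoˡ-≤ 1 (^-monoˡ-≤ (suc m) p≤q))
  binomialPrefix-chernoff {p} {q} p≤q (suc m) (suc n) = begin
    (G₁ + G₀) * (p ^ suc m * q ^ suc n)
      ≡⟨ solve 6 (λ G₁ G₀ p q P Q → (G₁ :+ G₀) :* ((p :* P) :* (q :* Q))
                    := q :* (G₁ :* ((p :* P) :* Q)) :+ p :* q :* (G₀ :* (P :* Q)))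
                 refl G₁ G₀ p q (p ^ m) (q ^ n) ⟩
    q * (G₁ * (p ^ suc m * q ^ n)) + p * q * (G₀ * (p ^ m * q ^ n))
      ≤⟨ +-mono-≤ (*-monoʳ-≤ q (binomialPrefix-chernoff p≤q (suc m) n))
                  (*-monoʳ-≤ (p * q) (binomialPrefix-chernoff p≤q m n)) ⟩
    q * (q ^ suc m * (p + q) ^ n) + p * q * (q ^ m * (p + q) ^ n)
      ≡⟨ solve 4 (λ p q Q′ R → q :* ((q :* Q′) :* R) :+ p :* q :* (Q′ :* R)
                    := (q :* Q′) :* ((p :+ q) :* R))
                 refl p q (q ^ m) ((p + q) ^ n) ⟩
    q ^ suc m * (p + q) ^ suc n
      ∎
    where
    open ≤-Reasoning
    G₁ = binomialPrefix (suc m) n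
    G₀ = binomialPrefix m n

  ^-distribʳ-* : ∀ x y n → (x * y) ^ n ≡ x ^ n * y ^ n
  ^-distribʳ-* x y zero    = refl
  ^-distribʳ-* x y (suc n) =
    trans (cong (x * y *_) (^-distribʳ-* x y n)) (*-interchange x y (x ^ n) (y ^ n))

  ^-comm : ∀ a i j → (a ^ i) ^ j ≡ (a ^ j) ^ i
  ^-comm a i j = trans (^-*-assoc a i j) (trans (cong (a ^_) (*-comm i j)) (sym (^-*-assoc a j i)))

  ^-cancelˡ-< : ∀ k {x y} → x ^ k < y ^ k → x < y
  ^-cancelˡ-< k xᵏ<yᵏ = ≰⇒> (λ y≤x → <⇒≱ xᵏ<yᵏ (^-monoˡ-≤ k y≤x))

  ^-exchange : ∀ {p q i j} → p ≤ q → i ≤ j → q ^ i * p ^ j ≤ p ^ i * q ^ j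
  ^-exchange {p} {q} {i} {j} p≤q i≤j = begin
    q ^ i * p ^ j           ≡⟨ cong (λ k → q ^ i * p ^ k) (m+[n∸m]≡n i≤j) ⟨
    q ^ i * p ^ (i + d)     ≡⟨ cong (q ^ i *_) (^-distribˡ-+-* p i d) ⟩
    q ^ i * (p ^ i * p ^ d) ≤⟨ *-monoʳ-≤ (q ^ i) (*-monoʳ-≤ (p ^ i) (^-monoˡ-≤ d p≤q)) ⟩
    q ^ i * (p ^ i * q ^ d) ≡⟨ x∙yz≈y∙xz (q ^ i) (p ^ i) (q ^ d) ⟩
    p ^ i * (q ^ i * q ^ d) ≡⟨ cong (p ^ i *_) (^-distribˡ-+-* q i d) ⟨
    p ^ i * q ^ (i + d)     ≡⟨ cong (λ k → p ^ i * q ^ k) (m+[n∸m]≡n i≤j) ⟩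
    p ^ i * q ^ j           ∎
    where
    open ≤-Reasoning
    d = j ∸ i

  [aⁱbʲ]ⁿ : ∀ a i b j n → (a ^ i * b ^ j) ^ n ≡ (a ^ n) ^ i * (b ^ n) ^ j
  [aⁱbʲ]ⁿ a i b j n = trans (^-distribʳ-* (a ^ i) (b ^ j) n) (cong₂ _*_ (^-comm a i n) (^-comm b j n))

  A₀ B₀ : ℕ
  A₀ = 9 ^ 9 * 11 ^ 20
  B₀ = 11 ^ 9 * 20 ^ 20

  -- Chernoff at p/q = 9/11 bounds the prefix by (11/9)^m (20/11)^n; the twentieth power turns
  -- the constraint m ≤ 9n/20 into integer exponents.
  binomialPrefix^20-bound : ∀ {m n} → 20 * m ≤ 9 * n → binomialPrefix m n ^ 20 * A₀ ^ n ≤ B₀ ^ n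
  binomialPrefix^20-bound {m} {n} 20m≤9n = *-cancelˡ-≤ ((9 ^ m) ^ 20) {{m^n≢0 (9 ^ m) 20 {{m^n≢0 9 m}}}} (begin
    (9 ^ m) ^ 20 * (G ^ 20 * A₀ ^ n)
      ≡⟨ cong (λ x → (9 ^ m) ^ 20 * (G ^ 20 * x)) ([aⁱbʲ]ⁿ 9 9 11 20 n) ⟩
    (9 ^ m) ^ 20 * (G ^ 20 * ((9 ^ n) ^ 9 * (11 ^ n) ^ 20))
      ≡⟨ solve 4 (λ G X Y Z → X :^ 20 :* (G :^ 20 :* (Z :^ 9 :* Y :^ 20))
                    := (G :* (X :* Y)) :^ 20 :* Z :^ 9) refl G (9 ^ m) (11 ^ n) (9 ^ n) ⟩
    (G * (9 ^ m * 11 ^ n)) ^ 20 * (9 ^ n) ^ 9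
      ≤⟨ *-monoˡ-≤ ((9 ^ n) ^ 9) (^-monoˡ-≤ 20 (binomialPrefix-chernoff 9≤11 m n)) ⟩
    (11 ^ m * 20 ^ n) ^ 20 * (9 ^ n) ^ 9
      ≡⟨ solve 3 (λ X Y Z → (X :* Y) :^ 20 :* Z := X :^ 20 :* Z :* Y :^ 20) refl (11 ^ m) (20 ^ n) ((9 ^ n) ^ 9) ⟩
    (11 ^ m) ^ 20 * (9 ^ n) ^ 9 * (20 ^ n) ^ 20
      ≡⟨ cong₂ (λ x y → x * y * (20 ^ n) ^ 20) (^-*-assoc 11 m 20) (^-*-assoc 9 n 9) ⟩
    11 ^ (m * 20) * 9 ^ (n * 9) * (20 ^ n) ^ 20
      ≤⟨ *-monoˡ-≤ ((20 ^ n) ^ 20) (^-exchange 9≤11 (subst₂ _≤_ (*-comm 20 m) (*-comm 9 n) 20m≤9n)) ⟩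
    9 ^ (m * 20) * 11 ^ (n * 9) * (20 ^ n) ^ 20
      ≡⟨ cong₂ (λ x y → x * y * (20 ^ n) ^ 20) (^-*-assoc 9 m 20) (^-*-assoc 11 n 9) ⟨
    (9 ^ m) ^ 20 * (11 ^ n) ^ 9 * (20 ^ n) ^ 20
      ≡⟨ *-assoc ((9 ^ m) ^ 20) _ _ ⟩
    (9 ^ m) ^ 20 * ((11 ^ n) ^ 9 * (20 ^ n) ^ 20)
      ≡⟨ cong ((9 ^ m) ^ 20 *_) ([aⁱbʲ]ⁿ 11 9 20 20 n) ⟨
    (9 ^ m) ^ 20 * B₀ ^ n
      ∎)
    where
    open ≤-Reasoning
    G = binomialPrefix m n
    9≤11 : 9 ≤ 11
    9≤11 = m≤m+n 9 2

  -- Bernoulli's inequality (1 + 1/b)ⁿ ≥ 1 + n/b, cleared of denominators.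
  ^-bernoulli : ∀ b n → b ^ n * (b + n) ≤ b * suc b ^ n
  ^-bernoulli b zero    = ≤-reflexive (solve 1 (λ b → con 1 :* (b :+ con 0) := b :* con 1) refl b)
  ^-bernoulli b (suc n) = begin
    b ^ suc n * (b + suc n)                  ≤⟨ m≤m+n _ (b ^ n * n) ⟩
    b ^ suc n * (b + suc n) + b ^ n * n      ≡⟨ solve 3 (λ b X n → (b :* X) :* (b :+ (con 1 :+ n)) :+ X :* n
                                                           := (con 1 :+ b) :* (X :* (b :+ n))) refl b (b ^ n) n ⟩
    suc b * (b ^ n * (b + n))                ≤⟨ *-monoʳ-≤ (suc b) (^-bernoulli b n) ⟩
    suc b * (b * suc b ^ n)                  ≡⟨ x∙yz≈y∙xz (suc b) b (suc b ^ n) ⟩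
    b * suc b ^ suc n                        ∎
    where open ≤-Reasoning

  K*b≤n⇒K*bⁿ<aⁿ : ∀ K {a b n} → 0 < b → b < a → K * b ≤ n → K * b ^ n < a ^ n
  K*b≤n⇒K*bⁿ<aⁿ K {a} {b} {n} 0<b b<a Kb≤n = *-cancelˡ-< b (K * b ^ n) (a ^ n) (begin-strict
    b * (K * b ^ n)  ≡⟨ solve 3 (λ b K X → b :* (K :* X) := X :* (K :* b)) refl b K (b ^ n) ⟩
    b ^ n * (K * b)  <⟨ *-monoʳ-< (b ^ n) {{m^n≢0 b n}} (≤-<-trans Kb≤n (m<n+m n 0<b)) ⟩
    b ^ n * (b + n)  ≤⟨ ^-bernoulli b n ⟩
    b * suc b ^ n    ≤⟨ *-monoʳ-≤ b (^-monoˡ-≤ n b<a) ⟩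
    b * a ^ n        ∎)
    where
    open ≤-Reasoning
    instance b≢0 = >-nonZero 0<b

  20*m45≤9*n : ∀ n → 20 * m45 n ≤ 9 * n
  20*m45≤9*n n = subst (_≤ 9 * n) (*-comm (m45 n) 20) (m/n*n≤m (9 * n) 20)

  binomialPrefix-m45-negligible : ∀ D → ∃[ N ] ∀ n → N ≤ n → binomialPrefix (m45 n) n * D < 2 ^ n
  binomialPrefix-m45-negligible D = D ^ 20 * B₀ , λ n N≤n →
    ^-cancelˡ-< 20 (*-cancelʳ-< (A₀ ^ n) _ _ (bound n N≤n))
    where
    bound : ∀ n → D ^ 20 * B₀ ≤ n → (binomialPrefix (m45 n) n * D) ^ 20 * A₀ ^ n < (2 ^ n) ^ 20 * A₀ ^ n
    bound n N≤n = begin-strict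
      (G * D) ^ 20 * A₀ ^ n
        ≡⟨ solve 3 (λ G D X → (G :* D) :^ 20 :* X := D :^ 20 :* (G :^ 20 :* X)) refl G D (A₀ ^ n) ⟩
      D ^ 20 * (G ^ 20 * A₀ ^ n)
        ≤⟨ *-monoʳ-≤ (D ^ 20) (binomialPrefix^20-bound {m45 n} (20*m45≤9*n n)) ⟩
      D ^ 20 * B₀ ^ n
        <⟨ K*b≤n⇒K*bⁿ<aⁿ (D ^ 20) (<ᵇ⇒< 0 B₀ _) (<ᵇ⇒< B₀ (2 ^ 20 * A₀) _) N≤n ⟩
      (2 ^ 20 * A₀) ^ n
        ≡⟨ trans (^-distribʳ-* (2 ^ 20) A₀ n) (cong (_* A₀ ^ n) (^-comm 2 20 n)) ⟩
      (2 ^ n) ^ 20 * A₀ ^ n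
        ∎
      where
      open ≤-Reasoning
      G = binomialPrefix (m45 n) n

  length-bitStrings : ∀ n → length (bitStrings n) ≡ 2 ^ n
  length-bitStrings zero    = refl
  length-bitStrings (suc n) = begin
    length (bitStrings (suc n))                ≡⟨ length≡sumBy1 (bitStrings (suc n)) ⟩
    sumBy (λ _ → 1) (bitStrings (suc n))       ≡⟨ sumBy-concatMap (λ _ → 1) _ (bitStrings n) ⟩
    sumBy (λ _ → 2) (bitStrings n)             ≡⟨ sumBy-const 2 (bitStrings n) ⟩
    length (bitStrings n) * 2                  ≡⟨ cong (_* 2) (length-bitStrings n) ⟩
    2 ^ n * 2                                  ≡⟨ *-comm (2 ^ n) 2 ⟩
    2 ^ suc n                                  ∎
    where open ≡-Reasoning

  length-tLists>0 : ∀ k → 0 < length (tLists k)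
  length-tLists>0 zero                = s≤s z≤n
  length-tLists>0 (suc zero)          = s≤s z≤n
  length-tLists>0 (suc (suc zero))    = s≤s z≤n
  length-tLists>0 (suc (suc (suc k))) with tLists (suc (suc k)) | length-tLists>0 (suc (suc k))
  ... | _ ∷ _ | _ = s≤s z≤n

  module _ (n : ℕ) where

    private
      m  = m45 n
      YS = bitStrings n
      VS = bitStrings m
      TS = tLists m

    failures-E1≤ : failures (E1 n) (Ω n) ≤ length VS * (length TS * binomialPrefix m n)
    failures-E1≤ = begin
      failures (E1 n) (Ω n)
        ≡⟨ sumBy-triples (λ ω → 𝟙¬ (E1 n ω)) YS VS TS ⟩
      sumBy (λ vs → sumBy (λ ts → sumBy (λ y → 𝟙¬ (E1 n (y , vs , ts))) YS) TS) VS
        ≤⟨ sumBy-mono (λ vs → sumBy-mono (λ ts → failures-given vs ts) TS) VS ⟩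
      sumBy (λ _ → sumBy (λ _ → binomialPrefix m n) TS) VS
        ≡⟨ trans (sumBy-cong (λ _ → sumBy-const _ TS) VS) (sumBy-const _ VS) ⟩
      length VS * (length TS * binomialPrefix m n)
        ∎
      where
      open ≤-Reasoning
      failures-given : ∀ vs ts → sumBy (λ y → 𝟙¬ (E1 n (y , vs , ts))) YS ≤ binomialPrefix m n
      failures-given vs ts = begin
        sumBy (λ y → 𝟙¬ (E1 n (y , vs , ts))) YS
          ≤⟨ sumBy-mono (λ y → 𝟙¬-≤-dec (Zm ⊆? y) (E1-if-⊆ n y vs ts)) YS ⟩
        avoiders Zm n
          ≡⟨ avoiders≡binomialPrefix Zm n ⟩
        binomialPrefix (length Zm) n
          ≡⟨ cong (λ k → binomialPrefix k n) (length-Zk _ _ m) ⟩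
        binomialPrefix m n
          ∎
        where Zm = ZkOf vs ts m

    length-Ω : length (Ω n) ≡ length VS * (length TS * 2 ^ n)
    length-Ω = begin
      length (Ω n)
        ≡⟨ length≡sumBy1 (Ω n) ⟩
      sumBy (λ _ → 1) (Ω n)
        ≡⟨ sumBy-triples (λ _ → 1) YS VS TS ⟩
      sumBy (λ _ → sumBy (λ _ → sumBy (λ _ → 1) YS) TS) VS
        ≡⟨ sumBy-cong (λ _ → sumBy-cong (λ _ → sym (length≡sumBy1 YS)) TS) VS ⟩
      sumBy (λ _ → sumBy (λ _ → length YS) TS) VS
        ≡⟨ trans (sumBy-cong (λ _ → sumBy-const _ TS) VS) (sumBy-const _ VS) ⟩
      length VS * (length TS * length YS)
        ≡⟨ cong (λ k → length VS * (length TS * k)) (length-bitStrings n) ⟩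
      length VS * (length TS * 2 ^ n)
        ∎
      where open ≡-Reasoning

    failures-E1-negligible : ∀ D → binomialPrefix m n * D < 2 ^ n → failures (E1 n) (Ω n) * D < length (Ω n)
    failures-E1-negligible D G*D<2ⁿ = begin-strict
      failures (E1 n) (Ω n) * D
        ≤⟨ *-monoˡ-≤ D failures-E1≤ ⟩
      length VS * (length TS * binomialPrefix m n) * D
        ≡⟨ trans (*-assoc (length VS) _ D) (cong (length VS *_) (*-assoc (length TS) _ D)) ⟩
      length VS * (length TS * (binomialPrefix m n * D))
        <⟨ *-monoʳ-< (length VS) (*-monoʳ-< (length TS) G*D<2ⁿ) ⟩
      length VS * (length TS * 2 ^ n)
        ≡⟨ length-Ω ⟨
      length (Ω n)
        ∎
      where
      open ≤-Reasoning
      instance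
        VS≢0 = >-nonZero (subst (0 <_) (sym (length-bitStrings m)) (m^n>0 2 m))
        TS≢0 = >-nonZero (length-tLists>0 m)

open Counting using (failures; length-filterᵇ+failures; binomialPrefix-m45-negligible; failures-E1-negligible)

open import Data.Nat as ℕ using (ℕ; suc; _≤_)
import Data.Nat.Properties as ℕ
open import Data.Integer as ℤ using (+_; +[1+_]; +<+)
import Data.Integer.Properties as ℤ
open import Data.Integer.Solver using (module +-*-Solver)
open import Data.Rational using (ℚ; mkℚ; 0ℚ; 1ℚ; _<_; _-_; -_; ∣_∣; _/_; ↧ₙ_; toℚᵘ; Positive; positive)
open import Data.Rational.Properties
  using (toℚᵘ-cancel-<; toℚᵘ-homo-∣-∣; toℚᵘ-homo-+; toℚᵘ-homo‿-; toℚᵘ-fromℚᵘ)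
open import Data.Rational.Unnormalised as ℚᵘ using (mkℚᵘ; 1ℚᵘ; *≡*; *<*)
  renaming (_≃_ to _≃ᵘ_; _<_ to _<ᵘ_)
import Data.Rational.Unnormalised.Properties as ℚᵘ

1-g/t≃b/t : ∀ {g b t} → g ℕ.+ b ≡ suc t → 1ℚᵘ ℚᵘ.- mkℚᵘ (+ g) t ≃ᵘ mkℚᵘ (+ b) t
1-g/t≃b/t {g} {b} {t} g+b≡1+t = *≡* (begin
  (1ℤ ℤ.* + suc t ℤ.+ ℤ.- + g ℤ.* 1ℤ) ℤ.* + suc t
    ≡⟨ cong (λ T → (1ℤ ℤ.* T ℤ.+ ℤ.- + g ℤ.* 1ℤ) ℤ.* + suc t) (trans (cong +_ (sym g+b≡1+t)) (ℤ.pos-+ g b)) ⟩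
  (1ℤ ℤ.* (+ g ℤ.+ + b) ℤ.+ ℤ.- + g ℤ.* 1ℤ) ℤ.* + suc t
    ≡⟨ solve 3 (λ G B T → (con 1ℤ :* (G :+ B) :+ :- G :* con 1ℤ) :* T := B :* T) refl (+ g) (+ b) (+ suc t) ⟩
  + b ℤ.* + suc t
    ≡⟨ cong (λ k → + b ℤ.* + suc k) (ℕ.+-identityʳ t) ⟨
  + b ℤ.* + suc (t ℕ.+ 0)
    ∎)
  where
  open ≡-Reasoning
  open +-*-Solver
  1ℤ = + 1

-- ε ≥ 1 / ↧ε since its numerator is at least 1.
+b/t<ε : ∀ {ε} → Positive ε → ∀ {b t} → b ℕ.* ↧ₙ ε ℕ.< suc t → mkℚᵘ (+ b) t <ᵘ toℚᵘ ε
+b/t<ε {mkℚ +[1+ a ] d _} _ {b} {t} b*d<1+t =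
  *<* (subst₂ ℤ._<_ (ℤ.pos-* b (suc d)) (ℤ.pos-* (suc a) (suc t))
        (+<+ (ℕ.<-≤-trans b*d<1+t (ℕ.m≤m+n (suc t) (a ℕ.* suc t)))))

∣1-g/t∣<ε : ∀ {ε} → 0ℚ < ε → ∀ {g b t} → g ℕ.+ b ≡ suc t → b ℕ.* ↧ₙ ε ℕ.< suc t →
            ∣ 1ℚ - + g / suc t ∣ < ε
∣1-g/t∣<ε {ε} ε>0 {g} {b} {t} g+b≡1+t b*d<1+t = toℚᵘ-cancel-< (begin-strict
  toℚᵘ ∣ 1ℚ - x ∣                       ≃⟨ toℚᵘ-homo-∣-∣ (1ℚ - x) ⟩
  ℚᵘ.∣ toℚᵘ (1ℚ - x) ∣                  ≃⟨ ℚᵘ.∣-∣-cong (toℚᵘ-homo-+ 1ℚ (- x)) ⟩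
  ℚᵘ.∣ 1ℚᵘ ℚᵘ.+ toℚᵘ (- x) ∣             ≃⟨ ℚᵘ.∣-∣-cong (ℚᵘ.+-congʳ 1ℚᵘ -x≃-g/t) ⟩
  ℚᵘ.∣ 1ℚᵘ ℚᵘ.- mkℚᵘ (+ g) t ∣           ≃⟨ ℚᵘ.∣-∣-cong (1-g/t≃b/t g+b≡1+t) ⟩
  mkℚᵘ (+ b) t                          <⟨ +b/t<ε (positive ε>0) b*d<1+t ⟩
  toℚᵘ ε                                ∎)
  where
  open ℚᵘ.≤-Reasoning
  x = + g / suc t
  -x≃-g/t = ℚᵘ.≃-trans (toℚᵘ-homo‿- x) (ℚᵘ.-‿cong (toℚᵘ-fromℚᵘ (mkℚᵘ (+ g) t)))

prob-close : ∀ {ε} → 0ℚ < ε → ∀ {A : Set} (P : A → Bool) xs →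
             failures P xs ℕ.* ↧ₙ ε ℕ.< length xs → ∣ 1ℚ - prob P xs ∣ < ε
prob-close ε>0 P []       ()
prob-close ε>0 P (x ∷ xs) failures*d<length =
  ∣1-g/t∣<ε ε>0 {g = length (filterᵇ P (x ∷ xs))} (length-filterᵇ+failures P (x ∷ xs)) failures*d<length

lemma4p2 : ∀ (ε : ℚ) → 0ℚ < ε → ∃[ N ] ∀ (n : ℕ) → N ≤ n → ∣ 1ℚ - PE1 n ∣ < ε
lemma4p2 ε ε>0 =
  let N , negligible = binomialPrefix-m45-negligible (↧ₙ ε) in
  N , λ n N≤n → prob-close ε>0 (E1 n) (Ω n) (failures-E1-negligible n (↧ₙ ε) (negligible n N≤n))
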